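{- Let $m\ge1$ and let $H_m$ be the group of all matrices $M\in\operatorname{GL}(2m,2)$ with $M(Q_m)=Q_m$ and $M(S_m)=S_m$, acting naturally on $\mathbb{F}_2^{2m}$. Then the orbits of $H_m$ on $\mathbb{F}_2^{2m}$ are exactly $\{\bar 0\}$, $S_m\setminus\{\bar 0\}$, $Q_m\setminus S_m$, and $\mathbb{F}_2^{2m}\setminus Q_m$.
   Context: Vectors of $\mathbb{F}_2^{2m}$ are written $\bar v=\binom{\bar v_1}{\bar v_2}$ with $\bar v_1,\bar v_2\in\mathbb{F}_2^m$. $Q_m=\{\bar v\mid \bar v_1^T\bar v_2=0\}$ and $S_m=\{\bar v\mid\bar v_2=\bar 0\}$. -}

module Defs where

open import Data.Bool using (Bool; true; false; _xor_; _∧_)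
open import Data.Nat using (ℕ; _+_)
open import Data.Fin using (Fin)
open import Data.Fin.Properties using (_≟_)
open import Data.Vec using (Vec; map; zipWith; foldr; take; drop; replicate; tabulate; transpose)
open import Data.Product using (Σ; _×_; _,_)
open import Data.Sum using (_⊎_)
open import Relation.Binary.PropositionalEquality using (_≡_)
open import Relation.Nullary using (¬_)
open import Relation.Nullary.Decidable using (⌊_⌋)

-- The field F₂ is Bool with addition _xor_ and multiplication _∧_.
F₂ : Set
F₂ = Bool

Vecₙ : ℕ → Set
Vecₙ n = Vec F₂ n

dot : ∀ {n} → Vecₙ n → Vecₙ n → F₂
dot u v = foldr _ _xor_ false (zipWith _∧_ u v)

zeroV : ∀ {n} → Vecₙ n
zeroV = replicate _ false

-- n×n matrices over F₂, stored as a vector of rows.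
Mat : ℕ → Set
Mat n = Vec (Vec F₂ n) n

act : ∀ {n} → Mat n → Vecₙ n → Vecₙ n
act M v = map (λ row → dot row v) M

_⊗_ : ∀ {n} → Mat n → Mat n → Mat n
A ⊗ B = map (λ r → map (λ c → dot r c) (transpose B)) A

idMat : ∀ {n} → Mat n
idMat = tabulate (λ i → tabulate (λ j → ⌊ i ≟ j ⌋))

InGL : ∀ {n} → Mat n → Set
InGL {n} M = Σ (Mat n) (λ N → (M ⊗ N ≡ idMat) × (N ⊗ M ≡ idMat))

-- Vectors of F₂^{2m} are v = (v₁ ; v₂) with v₁ = first m, v₂ = last m coordinates.
top : ∀ m → Vecₙ (m + m) → Vecₙ m
top m v = take m v

bot : ∀ m → Vecₙ (m + m) → Vecₙ m
bot m v = drop m v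

InQ : ∀ m → Vecₙ (m + m) → Set
InQ m v = dot (top m v) (bot m v) ≡ false

InS : ∀ m → Vecₙ (m + m) → Set
InS m v = bot m v ≡ zeroV

PreservesSet : ∀ {n} → Mat n → (Vecₙ n → Set) → Set
PreservesSet {n} M X =
  (∀ v → X v → X (act M v)) × (∀ w → X w → Σ (Vecₙ n) (λ v → X v × (act M v ≡ w)))

InH : ∀ m → Mat (m + m) → Set
InH m M = InGL M × PreservesSet M (InQ m) × PreservesSet M (InS m)

SameOrbit : ∀ m → Vecₙ (m + m) → Vecₙ (m + m) → Set
SameOrbit m v w = Σ (Mat (m + m)) (λ M → InH m M × (act M v ≡ w))

Block₀ Block₁ Block₂ Block₃ : ∀ m → Vecₙ (m + m) → Set
Block₀ m v = v ≡ zeroV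
Block₁ m v = InS m v × ¬ (v ≡ zeroV)
Block₂ m v = InQ m v × ¬ InS m v
Block₃ m v = ¬ InQ m v

SameBlock : ∀ m → Vecₙ (m + m) → Vecₙ (m + m) → Set
SameBlock m v w =
  (Block₀ m v × Block₀ m w) ⊎ (Block₁ m v × Block₁ m w) ⊎
  (Block₂ m v × Block₂ m w) ⊎ (Block₃ m v × Block₃ m w)

Inhabited : ∀ {n} → (Vecₙ n → Set) → Set
Inhabited {n} X = Σ (Vecₙ n) X

module Submission where

-- Every M ∈ H_m is linear and invertible with M⁻¹ ∈ H_m, so M fixes 0 and maps
-- each of {0}, S_m, Q_m and their complements onto themselves; hence an orbit
-- never leaves one of the four blocks {0}, S∖{0}, Q∖S, F₂^{2m}∖Q.
--
-- Conversely, each non-zero block is a single orbit.  Writing v = (x ; y), two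
-- kinds of elements of H_m suffice:
--   * diagonal matrices diag(P, R) with (Px)ᵀ(Ry) = xᵀy, e.g. R = (P⁻¹)ᵀ;
--   * shears [[I, A], [0, I]] with A alternating, i.e. (Ay)ᵀy = 0 for all y.
-- Since GL(m,2) is transitive on non-zero vectors, a diagonal matrix moves
-- (x ; 0), x ≠ 0, to (e₁ ; 0), and moves (x ; y), y ≠ 0, to some (x′ ; e₁);
-- a shear then clears x′ below its first coordinate, which is the invariant
-- xᵀy.  So S∖{0}, Q∖S and F₂^{2m}∖Q are the orbits of (e₁;0), (0;e₁), (e₁;e₁).

open import Defs
open import Algebra.Bundles using (CommutativeRing)
open import Data.Bool using (true; false; _xor_; _∧_)
open import Data.Bool.Properties
  using ( xor-∧-commutativeRing; xor-assoc; xor-same; xor-identityˡ; xor-identityʳ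
        ; ∧-comm; ∧-assoc; ∧-identityʳ; ∧-zeroʳ; ∧-distribʳ-xor; ¬-not )
  renaming (_≟_ to _≟ᵇ_)
open import Algebra.Properties.CommutativeSemigroup
  (CommutativeRing.+-commutativeSemigroup xor-∧-commutativeRing)
  using () renaming (interchange to xor-interchange)
open import Data.Nat using (ℕ; zero; suc; _+_; _≤_)
open import Data.Fin using (Fin; zero; suc)
open import Data.Fin.Properties using (_≟_)
open import Data.Vec
  using (Vec; []; _∷_; map; zipWith; take; drop; replicate; tabulate; transpose; lookup; _++_)
open import Data.Vec.Properties
  using ( ≡-dec; ∷-injective; map-cong; map-id; lookup-map; map-++; map-replicate
        ; zipWith-assoc; zipWith-identityˡ; zipWith-identityʳ
        ; zipWith-is-⊛; tabulate-∘; tabulate-cong; tabulate∘lookup; take++drop≡id )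
open import Data.Product using (Σ; _×_; _,_; proj₁; proj₂)
open import Data.Sum using (inj₁; inj₂)
open import Data.Empty using (⊥-elim)
open import Function using (_∘_)
open import Function.Bundles using (_⇔_; mk⇔; Equivalence)
open import Relation.Nullary using (¬_; yes; no)
open import Relation.Nullary.Decidable using (⌊_⌋)
open import Relation.Binary.PropositionalEquality
open ≡-Reasoning

open Equivalence using (to; from)

infixl 6 _⊕_
infixl 7 _·_

_⊕_ : ∀ {n} → Vecₙ n → Vecₙ n → Vecₙ n
_⊕_ = zipWith _xor_

-- The scalar multiple c·u, with the scalar on the right as it arises from
-- a column of a matrix.
_·_ : ∀ {n} → Vecₙ n → F₂ → Vecₙ n
u · c = map (_∧ c) u

⊕-assoc : ∀ {n} (u v w : Vecₙ n) → (u ⊕ v) ⊕ w ≡ u ⊕ (v ⊕ w)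
⊕-assoc = zipWith-assoc xor-assoc

⊕-identityˡ : ∀ {n} (u : Vecₙ n) → zeroV ⊕ u ≡ u
⊕-identityˡ = zipWith-identityˡ xor-identityˡ

⊕-identityʳ : ∀ {n} (u : Vecₙ n) → u ⊕ zeroV ≡ u
⊕-identityʳ = zipWith-identityʳ xor-identityʳ

⊕-self : ∀ {n} (u : Vecₙ n) → u ⊕ u ≡ zeroV
⊕-self [] = refl
⊕-self (a ∷ u) = cong₂ _∷_ (xor-same a) (⊕-self u)

⊕-cancelˡ : ∀ {n} (u v : Vecₙ n) → u ⊕ (u ⊕ v) ≡ v
⊕-cancelˡ u v = begin
  u ⊕ (u ⊕ v)  ≡⟨ ⊕-assoc u u v ⟨
  (u ⊕ u) ⊕ v  ≡⟨ cong (_⊕ v) (⊕-self u) ⟩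
  zeroV ⊕ v    ≡⟨ ⊕-identityˡ v ⟩
  v            ∎

⊕-cancelʳ : ∀ {n} (u v : Vecₙ n) → (u ⊕ v) ⊕ v ≡ u
⊕-cancelʳ u v = begin
  (u ⊕ v) ⊕ v  ≡⟨ ⊕-assoc u v v ⟩
  u ⊕ (v ⊕ v)  ≡⟨ cong (u ⊕_) (⊕-self v) ⟩
  u ⊕ zeroV    ≡⟨ ⊕-identityʳ u ⟩
  u            ∎

·-true : ∀ {n} (u : Vecₙ n) → u · true ≡ u
·-true u = trans (map-cong ∧-identityʳ u) (map-id u)

zero-· : ∀ {n} (c : F₂) → zeroV {n} · c ≡ zeroV
zero-· {n} c = map-replicate (_∧ c) false n

dot-comm : ∀ {n} (u v : Vecₙ n) → dot u v ≡ dot v u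
dot-comm [] [] = refl
dot-comm (a ∷ u) (b ∷ v) = cong₂ _xor_ (∧-comm a b) (dot-comm u v)

dot-zeroʳ : ∀ {n} (u : Vecₙ n) → dot u zeroV ≡ false
dot-zeroʳ [] = refl
dot-zeroʳ (a ∷ u) = cong₂ _xor_ (∧-zeroʳ a) (dot-zeroʳ u)

dot-zeroˡ : ∀ {n} (u : Vecₙ n) → dot zeroV u ≡ false
dot-zeroˡ u = trans (dot-comm zeroV u) (dot-zeroʳ u)

dot-⊕ˡ : ∀ {n} (u u′ v : Vecₙ n) → dot (u ⊕ u′) v ≡ dot u v xor dot u′ v
dot-⊕ˡ [] [] [] = refl
dot-⊕ˡ (a ∷ u) (a′ ∷ u′) (b ∷ v) = begin
  ((a xor a′) ∧ b) xor dot (u ⊕ u′) v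
    ≡⟨ cong₂ _xor_ (∧-distribʳ-xor b a a′) (dot-⊕ˡ u u′ v) ⟩
  ((a ∧ b) xor (a′ ∧ b)) xor (dot u v xor dot u′ v)
    ≡⟨ xor-interchange (a ∧ b) (a′ ∧ b) (dot u v) (dot u′ v) ⟩
  ((a ∧ b) xor dot u v) xor ((a′ ∧ b) xor dot u′ v)
    ∎

dot-⊕ʳ : ∀ {n} (u v v′ : Vecₙ n) → dot u (v ⊕ v′) ≡ dot u v xor dot u v′
dot-⊕ʳ u v v′ = begin
  dot u (v ⊕ v′)            ≡⟨ dot-comm u (v ⊕ v′) ⟩
  dot (v ⊕ v′) u            ≡⟨ dot-⊕ˡ v v′ u ⟩
  dot v u xor dot v′ u      ≡⟨ cong₂ _xor_ (dot-comm v u) (dot-comm v′ u) ⟩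
  dot u v xor dot u v′      ∎

dot-·ʳ : ∀ {n} (u v : Vecₙ n) c → dot u (v · c) ≡ dot u v ∧ c
dot-·ʳ [] [] c = refl
dot-·ʳ (a ∷ u) (b ∷ v) c = begin
  (a ∧ (b ∧ c)) xor dot u (v · c)  ≡⟨ cong₂ _xor_ (sym (∧-assoc a b c)) (dot-·ʳ u v c) ⟩
  ((a ∧ b) ∧ c) xor (dot u v ∧ c)  ≡⟨ ∧-distribʳ-xor c (a ∧ b) (dot u v) ⟨
  ((a ∧ b) xor dot u v) ∧ c        ∎

dot-·ˡ : ∀ {n} (u v : Vecₙ n) c → dot (u · c) v ≡ dot u v ∧ c
dot-·ˡ u v c = begin
  dot (u · c) v  ≡⟨ dot-comm (u · c) v ⟩
  dot v (u · c)  ≡⟨ dot-·ʳ v u c ⟩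
  dot v u ∧ c    ≡⟨ cong (_∧ c) (dot-comm v u) ⟩
  dot u v ∧ c    ∎

dot-++ : ∀ {m n} (a x : Vecₙ m) (b y : Vecₙ n) → dot (a ++ b) (x ++ y) ≡ dot a x xor dot b y
dot-++ [] [] b y = refl
dot-++ (c ∷ a) (d ∷ x) b y =
  trans (cong ((c ∧ d) xor_) (dot-++ a x b y)) (sym (xor-assoc (c ∧ d) (dot a x) (dot b y)))

vec-ext : ∀ {n} (a b : Vecₙ n) → (∀ z → dot a z ≡ dot b z) → a ≡ b
vec-ext [] [] _ = refl
vec-ext (a ∷ u) (b ∷ w) p = cong₂ _∷_ heads (vec-ext u w tails)
  where
  first : ∀ {n} c (v : Vecₙ n) → dot (c ∷ v) (true ∷ zeroV) ≡ c
  first c v = trans (cong₂ _xor_ (∧-identityʳ c) (dot-zeroʳ v)) (xor-identityʳ c)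
  heads : a ≡ b
  heads = trans (sym (first a u)) (trans (p (true ∷ zeroV)) (first b w))
  tails : ∀ z → dot u z ≡ dot w z
  tails z = begin
    dot u z                 ≡⟨ cong (_xor dot u z) (∧-zeroʳ a) ⟨
    (a ∧ false) xor dot u z ≡⟨ p (false ∷ z) ⟩
    (b ∧ false) xor dot w z ≡⟨ cong (_xor dot w z) (∧-zeroʳ b) ⟩
    dot w z                 ∎

mul : ∀ {n k} → Vec (Vecₙ n) k → Vecₙ n → Vecₙ k
mul B u = map (λ row → dot row u) B

mul-zero : ∀ {n k} (B : Vec (Vecₙ n) k) → mul B zeroV ≡ zeroV
mul-zero [] = refl
mul-zero (row ∷ B) = cong₂ _∷_ (dot-zeroʳ row) (mul-zero B)

mul-column : ∀ {n k} (b : Vecₙ k) (T : Vec (Vecₙ n) k) c y →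
  mul (zipWith _∷_ b T) (c ∷ y) ≡ b · c ⊕ mul T y
mul-column [] [] c y = refl
mul-column (a ∷ b) (t ∷ T) c y = cong (((a ∧ c) xor dot t y) ∷_) (mul-column b T c y)

transpose-∷ : ∀ {n k} (b : Vecₙ k) (B : Vec (Vecₙ k) n) →
  transpose (b ∷ B) ≡ zipWith _∷_ b (transpose B)
transpose-∷ b B = sym (zipWith-is-⊛ _∷_ b (transpose B))

dot-transpose : ∀ {n k} (B : Vec (Vecₙ n) k) (u : Vecₙ n) (y : Vecₙ k) →
  dot (mul B u) y ≡ dot u (mul (transpose B) y)
dot-transpose {n} [] u [] = begin
  false                                  ≡⟨ dot-zeroʳ u ⟨
  dot u zeroV                            ≡⟨ cong (dot u) (map-replicate (λ r → dot r []) [] n) ⟨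
  dot u (mul (transpose {n = n} []) [])  ∎
dot-transpose (b ∷ B) u (c ∷ y) = begin
  (dot b u ∧ c) xor dot (mul B u) y
    ≡⟨ cong₂ _xor_ (cong (_∧ c) (dot-comm b u)) (dot-transpose B u y) ⟩
  (dot u b ∧ c) xor dot u (mul (transpose B) y)
    ≡⟨ cong (_xor _) (dot-·ʳ u b c) ⟨
  dot u (b · c) xor dot u (mul (transpose B) y)
    ≡⟨ dot-⊕ʳ u (b · c) _ ⟨
  dot u (b · c ⊕ mul (transpose B) y)
    ≡⟨ cong (dot u) (mul-column b (transpose B) c y) ⟨
  dot u (mul (zipWith _∷_ b (transpose B)) (c ∷ y))
    ≡⟨ cong (λ T → dot u (mul T (c ∷ y))) (transpose-∷ b B) ⟨
  dot u (mul (transpose (b ∷ B)) (c ∷ y))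
    ∎

act-⊗ : ∀ {n} (A B : Mat n) v → act (A ⊗ B) v ≡ act A (act B v)
act-⊗ A B v = rows A
  where
  rows : ∀ {k} (A : Vec (Vecₙ _) k) →
    mul (map (λ r → map (λ c → dot r c) (transpose B)) A) v ≡ mul A (act B v)
  rows [] = refl
  rows (r ∷ A) = cong₂ _∷_ entry (rows A)
    where
    entry : dot (map (λ c → dot r c) (transpose B)) v ≡ dot r (act B v)
    entry = begin
      dot (map (λ c → dot r c) (transpose B)) v
        ≡⟨ cong (λ z → dot z v) (map-cong (dot-comm r) (transpose B)) ⟩
      dot (mul (transpose B) r) v   ≡⟨ dot-comm _ v ⟩
      dot v (mul (transpose B) r)   ≡⟨ dot-transpose B v r ⟨
      dot (act B v) r               ≡⟨ dot-comm _ r ⟩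
      dot r (act B v)               ∎

act-id : ∀ {n} (v : Vecₙ n) → act idMat v ≡ v
act-id v = begin
  map (λ row → dot row v) (tabulate (λ i → tabulate (λ j → ⌊ i ≟ j ⌋)))
    ≡⟨ tabulate-∘ _ _ ⟨
  tabulate (λ i → dot (tabulate (λ j → ⌊ i ≟ j ⌋)) v)
    ≡⟨ tabulate-cong (λ i → dot-unit i v) ⟩
  tabulate (lookup v)
    ≡⟨ tabulate∘lookup v ⟩
  v ∎
  where
  dot-none : ∀ {n} (v : Vecₙ n) → dot (tabulate {n = n} (λ _ → false)) v ≡ false
  dot-none [] = refl
  dot-none (_ ∷ v) = dot-none v
  ≟-suc : ∀ {n} (i j : Fin n) → ⌊ suc i ≟ suc j ⌋ ≡ ⌊ i ≟ j ⌋
  ≟-suc i j with i ≟ j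
  ... | yes _ = refl
  ... | no _ = refl
  dot-unit : ∀ {n} (i : Fin n) (v : Vecₙ n) → dot (tabulate (λ j → ⌊ i ≟ j ⌋)) v ≡ lookup v i
  dot-unit zero (x ∷ v) = trans (cong (x xor_) (dot-none v)) (xor-identityʳ x)
  dot-unit (suc i) (x ∷ v) =
    trans (cong (λ t → dot t v) (tabulate-cong (≟-suc i))) (dot-unit i v)

mat-ext : ∀ {n k} (A B : Vec (Vecₙ n) k) → (∀ v → mul A v ≡ mul B v) → A ≡ B
mat-ext [] [] _ = refl
mat-ext (a ∷ A) (b ∷ B) p =
  cong₂ _∷_ (vec-ext a b (proj₁ ∘ ∷-injective ∘ p)) (mat-ext A B (proj₂ ∘ ∷-injective ∘ p))

record Invertible (n : ℕ) : Set where
  field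
    M M⁻¹ : Mat n
    left  : ∀ v → act M⁻¹ (act M v) ≡ v
    right : ∀ v → act M (act M⁻¹ v) ≡ v

⊗-inverse : ∀ {n} (M N : Mat n) → M ⊗ N ≡ idMat → ∀ v → act M (act N v) ≡ v
⊗-inverse M N MN≡I v = begin
  act M (act N v)  ≡⟨ act-⊗ M N v ⟨
  act (M ⊗ N) v    ≡⟨ cong (λ T → act T v) MN≡I ⟩
  act idMat v      ≡⟨ act-id v ⟩
  v                ∎

inverse-⊗ : ∀ {n} (M N : Mat n) → (∀ v → act M (act N v) ≡ v) → M ⊗ N ≡ idMat
inverse-⊗ M N inv = mat-ext (M ⊗ N) idMat λ v →
  trans (act-⊗ M N v) (trans (inv v) (sym (act-id v)))

toInGL : ∀ {n} (g : Invertible n) → InGL (Invertible.M g)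
toInGL g = M⁻¹ , inverse-⊗ M M⁻¹ right , inverse-⊗ M⁻¹ M left
  where open Invertible g

involution : ∀ {n} (M : Mat n) → (∀ v → act M (act M v) ≡ v) → Invertible n
involution M inv = record { M = M ; M⁻¹ = M ; left = inv ; right = inv }

compose : ∀ {n} → Invertible n → Invertible n → Invertible n
compose g h = record
  { M = G.M ⊗ H.M
  ; M⁻¹ = H.M⁻¹ ⊗ G.M⁻¹
  ; left = λ v → begin
      act (H.M⁻¹ ⊗ G.M⁻¹) (act (G.M ⊗ H.M) v)   ≡⟨ act-⊗ H.M⁻¹ G.M⁻¹ _ ⟩
      act H.M⁻¹ (act G.M⁻¹ (act (G.M ⊗ H.M) v)) ≡⟨ cong (act H.M⁻¹ ∘ act G.M⁻¹) (act-⊗ G.M H.M v) ⟩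
      act H.M⁻¹ (act G.M⁻¹ (act G.M (act H.M v))) ≡⟨ cong (act H.M⁻¹) (G.left _) ⟩
      act H.M⁻¹ (act H.M v)                       ≡⟨ H.left v ⟩
      v                                           ∎
  ; right = λ v → begin
      act (G.M ⊗ H.M) (act (H.M⁻¹ ⊗ G.M⁻¹) v)   ≡⟨ act-⊗ G.M H.M _ ⟩
      act G.M (act H.M (act (H.M⁻¹ ⊗ G.M⁻¹) v)) ≡⟨ cong (act G.M ∘ act H.M) (act-⊗ H.M⁻¹ G.M⁻¹ v) ⟩
      act G.M (act H.M (act H.M⁻¹ (act G.M⁻¹ v))) ≡⟨ cong (act G.M) (H.right _) ⟩
      act G.M (act G.M⁻¹ v)                       ≡⟨ G.right v ⟩
      v                                           ∎
  }
  where module G = Invertible g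
        module H = Invertible h

transpose-inverse : ∀ {n} (A B : Mat n) → (∀ v → act A (act B v) ≡ v) →
  ∀ v → act (transpose B) (act (transpose A) v) ≡ v
transpose-inverse A B inv v = vec-ext _ _ λ z → begin
  dot (act (transpose B) (act (transpose A) v)) z  ≡⟨ dot-comm _ z ⟩
  dot z (act (transpose B) (act (transpose A) v))  ≡⟨ dot-transpose B z _ ⟨
  dot (act B z) (act (transpose A) v)              ≡⟨ dot-transpose A (act B z) v ⟨
  dot (act A (act B z)) v                          ≡⟨ cong (λ t → dot t v) (inv z) ⟩
  dot z v                                          ≡⟨ dot-comm z v ⟩
  dot v z                                          ∎

dual : ∀ {n} → Invertible n → Invertible n
dual g = record
  { M = transpose M⁻¹ ; M⁻¹ = transpose M
  ; left = transpose-inverse M⁻¹ M left ; right = transpose-inverse M M⁻¹ right }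
  where open Invertible g

dual-adjoint : ∀ {n} (g : Invertible n) (x y : Vecₙ n) →
  dot (act (Invertible.M (dual g)) x) (act (Invertible.M g) y) ≡ dot x y
dual-adjoint g x y = begin
  dot (act (transpose M⁻¹) x) (act M y)  ≡⟨ dot-comm _ (act M y) ⟩
  dot (act M y) (act (transpose M⁻¹) x)  ≡⟨ dot-transpose M⁻¹ (act M y) x ⟨
  dot (act M⁻¹ (act M y)) x              ≡⟨ cong (λ t → dot t x) (left y) ⟩
  dot y x                                ≡⟨ dot-comm y x ⟩
  dot x y                                ∎
  where open Invertible g

Preserves : ∀ {n} → Mat n → (Vecₙ n → Set) → Set
Preserves M X = ∀ v → X v → X (act M v)

preserves-⊗ : ∀ {n} {X : Vecₙ n → Set} (A B : Mat n) →
  Preserves A X → Preserves B X → Preserves (A ⊗ B) X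
preserves-⊗ {X = X} A B pA pB v x = subst X (sym (act-⊗ A B v)) (pA _ (pB v x))

-- An element of H_m: an invertible matrix such that it and its inverse map
-- Q_m into Q_m and S_m into S_m (equivalently M(Q_m) = Q_m, M(S_m) = S_m).
record Symmetry (m : ℕ) : Set where
  field
    g : Invertible (m + m)
  open Invertible g public
  field
    M-Q   : Preserves M   (InQ m)
    M⁻¹-Q : Preserves M⁻¹ (InQ m)
    M-S   : Preserves M   (InS m)
    M⁻¹-S : Preserves M⁻¹ (InS m)

symmetry-InH : ∀ {m} (h : Symmetry m) → InH m (Symmetry.M h)
symmetry-InH h = toInGL g , onto M-Q M⁻¹-Q , onto M-S M⁻¹-S
  where
  open Symmetry h
  onto : ∀ {X} → Preserves M X → Preserves M⁻¹ X → PreservesSet M X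
  onto pM pM⁻¹ = pM , λ w x → act M⁻¹ w , pM⁻¹ w x , right w

InH-symmetry : ∀ {m} (M : Mat (m + m)) → InH m M → Σ (Symmetry m) (λ h → Symmetry.M h ≡ M)
InH-symmetry {m} M ((N , MN≡I , NM≡I) , (M-Q , onto-Q) , (M-S , onto-S)) =
  record { g = g ; M-Q = M-Q ; M⁻¹-Q = back onto-Q ; M-S = M-S ; M⁻¹-S = back onto-S } , refl
  where
  g : Invertible (m + m)
  g = record { M = M ; M⁻¹ = N ; left = ⊗-inverse N M NM≡I ; right = ⊗-inverse M N MN≡I }
  -- If every w ∈ X is M v for some v ∈ X, then M⁻¹ w = v ∈ X.
  back : ∀ {X} → (∀ w → X w → Σ (Vecₙ (m + m)) (λ v → X v × act M v ≡ w)) → Preserves N X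
  back {X} onto w x with onto w x
  ... | v , xv , refl = subst X (sym (Invertible.left g v)) xv

identityH : ∀ {m} → Symmetry m
identityH {m} = record
  { g = involution idMat (λ v → trans (act-id _) (act-id v))
  ; M-Q = fixes (InQ m) ; M⁻¹-Q = fixes (InQ m) ; M-S = fixes (InS m) ; M⁻¹-S = fixes (InS m) }
  where
  fixes : ∀ X → Preserves idMat X
  fixes X v = subst X (sym (act-id v))

inverseH : ∀ {m} → Symmetry m → Symmetry m
inverseH h = record
  { g = record { M = M⁻¹ ; M⁻¹ = M ; left = right ; right = left }
  ; M-Q = M⁻¹-Q ; M⁻¹-Q = M-Q ; M-S = M⁻¹-S ; M⁻¹-S = M-S }
  where open Symmetry h

composeH : ∀ {m} → Symmetry m → Symmetry m → Symmetry m
composeH a b = record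
  { g = compose A.g B.g
  ; M-Q = preserves-⊗ A.M B.M A.M-Q B.M-Q ; M⁻¹-Q = preserves-⊗ B.M⁻¹ A.M⁻¹ B.M⁻¹-Q A.M⁻¹-Q
  ; M-S = preserves-⊗ A.M B.M A.M-S B.M-S ; M⁻¹-S = preserves-⊗ B.M⁻¹ A.M⁻¹ B.M⁻¹-S A.M⁻¹-S }
  where module A = Symmetry a
        module B = Symmetry b

Orbit : ∀ m → Vecₙ (m + m) → Vecₙ (m + m) → Set
Orbit m v w = Σ (Symmetry m) (λ h → act (Symmetry.M h) v ≡ w)

orbit-SameOrbit : ∀ {m v w} → Orbit m v w → SameOrbit m v w
orbit-SameOrbit (h , hv≡w) = Symmetry.M h , symmetry-InH h , hv≡w

SameOrbit-orbit : ∀ {m v w} → SameOrbit m v w → Orbit m v w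
SameOrbit-orbit (M , M∈H , Mv≡w) with InH-symmetry M M∈H
... | h , refl = h , Mv≡w

orbit-refl : ∀ {m} v → Orbit m v v
orbit-refl v = identityH , act-id v

orbit-sym : ∀ {m v w} → Orbit m v w → Orbit m w v
orbit-sym {v = v} (h , refl) = inverseH h , Symmetry.left h v

orbit-trans : ∀ {m u v w} → Orbit m u v → Orbit m v w → Orbit m u w
orbit-trans {u = u} (a , refl) (b , refl) = composeH b a , act-⊗ (Symmetry.M b) (Symmetry.M a) u

take-++ : ∀ {A : Set} m {n} (x : Vec A m) (y : Vec A n) → take m (x ++ y) ≡ x
take-++ zero [] y = refl
take-++ (suc m) (a ∷ x) y = cong (a ∷_) (take-++ m x y)

drop-++ : ∀ {A : Set} m {n} (x : Vec A m) (y : Vec A n) → drop m (x ++ y) ≡ y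
drop-++ zero [] y = refl
drop-++ (suc m) (a ∷ x) y = drop-++ m x y

split-elim : ∀ m (P : Vecₙ (m + m) → Set) → (∀ x y → P (x ++ y)) → ∀ v → P v
split-elim m P p v = subst P (take++drop≡id m v) (p (top m v) (bot m v))

inQ : ∀ m (x y : Vecₙ m) → dot x y ≡ false → InQ m (x ++ y)
inQ m x y = trans (cong₂ dot (take-++ m x y) (drop-++ m x y))

inQ⁻¹ : ∀ m (x y : Vecₙ m) → InQ m (x ++ y) → dot x y ≡ false
inQ⁻¹ m x y = trans (sym (cong₂ dot (take-++ m x y) (drop-++ m x y)))

inS : ∀ m (x y : Vecₙ m) → y ≡ zeroV → InS m (x ++ y)
inS m x y = trans (drop-++ m x y)

inS⁻¹ : ∀ m (x y : Vecₙ m) → InS m (x ++ y) → y ≡ zeroV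
inS⁻¹ m x y = trans (sym (drop-++ m x y))

block : ∀ {m} (A B C D : Mat m) → Mat (m + m)
block A B C D = zipWith _++_ A B ++ zipWith _++_ C D

act-block : ∀ {m} (A B C D : Mat m) (x y : Vecₙ m) →
  act (block A B C D) (x ++ y) ≡ (act A x ⊕ act B y) ++ (act C x ⊕ act D y)
act-block A B C D x y =
  trans (map-++ _ (zipWith _++_ A B) (zipWith _++_ C D)) (cong₂ _++_ (rows A B) (rows C D))
  where
  rows : ∀ {k} (A B : Vec (Vecₙ _) k) → mul (zipWith _++_ A B) (x ++ y) ≡ mul A x ⊕ mul B y
  rows [] [] = refl
  rows (a ∷ A) (b ∷ B) = cong₂ _∷_ (dot-++ a x b y) (rows A B)

zeroMat : ∀ {m} → Mat m
zeroMat = replicate _ zeroV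

act-zeroMat : ∀ {m} (x : Vecₙ m) → act zeroMat x ≡ zeroV
act-zeroMat {m} x = trans (map-replicate (λ row → dot row x) zeroV m) (cong (replicate m) (dot-zeroˡ x))

preserves-split : ∀ m (M : Mat (m + m)) (X : Vecₙ (m + m) → Set) →
  (∀ x y → X (x ++ y) → X (act M (x ++ y))) → Preserves M X
preserves-split m M X = split-elim m (λ v → X v → X (act M v))

-- Diagonal elements of H_m.

Compatible : ∀ {m} → Mat m → Mat m → Set
Compatible {m} P R = ∀ (x y : Vecₙ m) → dot (act P x) (act R y) ≡ dot x y

diag : ∀ {m} → Mat m → Mat m → Mat (m + m)
diag P R = block P zeroMat zeroMat R

act-diag : ∀ {m} (P R : Mat m) (x y : Vecₙ m) → act (diag P R) (x ++ y) ≡ act P x ++ act R y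
act-diag P R x y = begin
  act (diag P R) (x ++ y)                                    ≡⟨ act-block P zeroMat zeroMat R x y ⟩
  (act P x ⊕ act zeroMat y) ++ (act zeroMat x ⊕ act R y)    ≡⟨ cong₂ (λ a b → (act P x ⊕ a) ++ (b ⊕ act R y))
                                                                     (act-zeroMat y) (act-zeroMat x) ⟩
  (act P x ⊕ zeroV) ++ (zeroV ⊕ act R y)                    ≡⟨ cong₂ _++_ (⊕-identityʳ (act P x)) (⊕-identityˡ (act R y)) ⟩
  act P x ++ act R y                                         ∎

-- diag(P, R) ∈ H_m for invertible P, R compatible with the form: it maps
-- (x ; 0) to (Px ; 0), and preserves xᵀy.
diagonalH : ∀ {m} (p r : Invertible m) → Compatible (Invertible.M p) (Invertible.M r) → Symmetry m
diagonalH {m} p r compat = record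
  { g = record { M = diag P.M R.M ; M⁻¹ = diag P.M⁻¹ R.M⁻¹
               ; left = undo P.M R.M P.M⁻¹ R.M⁻¹ P.left R.left
               ; right = undo P.M⁻¹ R.M⁻¹ P.M R.M P.right R.right }
  ; M-Q = diag-Q P.M R.M compat ; M⁻¹-Q = diag-Q P.M⁻¹ R.M⁻¹ compat⁻¹
  ; M-S = diag-S P.M R.M ; M⁻¹-S = diag-S P.M⁻¹ R.M⁻¹ }
  where
  module P = Invertible p
  module R = Invertible r
  compat⁻¹ : Compatible P.M⁻¹ R.M⁻¹
  compat⁻¹ x y = begin
    dot (act P.M⁻¹ x) (act R.M⁻¹ y)                      ≡⟨ compat _ _ ⟨
    dot (act P.M (act P.M⁻¹ x)) (act R.M (act R.M⁻¹ y))  ≡⟨ cong₂ dot (P.right x) (R.right y) ⟩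
    dot x y                                              ∎
  undo : ∀ A B A′ B′ → (∀ x → act A′ (act A x) ≡ x) → (∀ y → act B′ (act B y) ≡ y) →
    ∀ v → act (diag A′ B′) (act (diag A B) v) ≡ v
  undo A B A′ B′ undoA undoB = split-elim m _ λ x y → begin
    act (diag A′ B′) (act (diag A B) (x ++ y))  ≡⟨ cong (act (diag A′ B′)) (act-diag A B x y) ⟩
    act (diag A′ B′) (act A x ++ act B y)       ≡⟨ act-diag A′ B′ _ _ ⟩
    act A′ (act A x) ++ act B′ (act B y)        ≡⟨ cong₂ _++_ (undoA x) (undoB y) ⟩
    x ++ y                                      ∎
  diag-Q : ∀ A B → Compatible A B → Preserves (diag A B) (InQ m)
  diag-Q A B c = preserves-split m _ (InQ m) λ x y q →
    subst (InQ m) (sym (act-diag A B x y)) (inQ m (act A x) (act B y) (trans (c x y) (inQ⁻¹ m x y q)))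
  diag-S : ∀ A B → Preserves (diag A B) (InS m)
  diag-S A B = preserves-split m _ (InS m) λ x y s →
    subst (InS m) (sym (act-diag A B x y)) (inS m (act A x) (act B y) (trans (cong (act B) (inS⁻¹ m x y s)) (mul-zero B)))

diagonalBottom : ∀ {m} → Invertible m → Symmetry m
diagonalBottom g = diagonalH (dual g) g (dual-adjoint g)

diagonalTop : ∀ {m} → Invertible m → Symmetry m
diagonalTop g = diagonalH g (dual g) λ x y →
  trans (dot-comm (act (Invertible.M g) x) _) (trans (dual-adjoint g y x) (dot-comm y x))

-- Shears.

Alternating : ∀ {m} → Mat m → Set
Alternating {m} A = ∀ (y : Vecₙ m) → dot (act A y) y ≡ false

shear : ∀ {m} → Mat m → Mat (m + m)
shear A = block idMat A zeroMat idMat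

act-shear : ∀ {m} (A : Mat m) (x y : Vecₙ m) → act (shear A) (x ++ y) ≡ (x ⊕ act A y) ++ y
act-shear A x y = begin
  act (shear A) (x ++ y)                                       ≡⟨ act-block idMat A zeroMat idMat x y ⟩
  (act idMat x ⊕ act A y) ++ (act zeroMat x ⊕ act idMat y)    ≡⟨ cong₂ (λ a b → (a ⊕ act A y) ++ b)
                                                                       (act-id x) (cong₂ _⊕_ (act-zeroMat x) (act-id y)) ⟩
  (x ⊕ act A y) ++ (zeroV ⊕ y)                                 ≡⟨ cong ((x ⊕ act A y) ++_) (⊕-identityˡ y) ⟩
  (x ⊕ act A y) ++ y                                           ∎

-- The shear [[I, A], [0, I]] with A alternating is an involution in H_m:
-- it fixes y and changes xᵀy by (Ay)ᵀy = 0.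
shearH : ∀ {m} (A : Mat m) → Alternating A → Symmetry m
shearH {m} A alternating = record
  { g = involution (shear A) twice
  ; M-Q = shear-Q ; M⁻¹-Q = shear-Q ; M-S = shear-S ; M⁻¹-S = shear-S }
  where
  twice : ∀ v → act (shear A) (act (shear A) v) ≡ v
  twice = split-elim m _ λ x y → begin
    act (shear A) (act (shear A) (x ++ y))  ≡⟨ cong (act (shear A)) (act-shear A x y) ⟩
    act (shear A) ((x ⊕ act A y) ++ y)      ≡⟨ act-shear A _ y ⟩
    ((x ⊕ act A y) ⊕ act A y) ++ y          ≡⟨ cong (_++ y) (⊕-cancelʳ x (act A y)) ⟩
    x ++ y                                  ∎
  shear-Q : Preserves (shear A) (InQ m)
  shear-Q = preserves-split m _ (InQ m) λ x y q →
    subst (InQ m) (sym (act-shear A x y)) (inQ m (x ⊕ act A y) y (begin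
      dot (x ⊕ act A y) y          ≡⟨ dot-⊕ˡ x (act A y) y ⟩
      dot x y xor dot (act A y) y  ≡⟨ cong₂ _xor_ (inQ⁻¹ m x y q) (alternating y) ⟩
      false                        ∎))
  shear-S : Preserves (shear A) (InS m)
  shear-S = preserves-split m _ (InS m) λ x y s →
    subst (InS m) (sym (act-shear A x y)) (inS m (x ⊕ act A y) y (inS⁻¹ m x y s))

outer : ∀ {n k} → Vecₙ k → Vecₙ n → Vec (Vecₙ n) k
outer u c = map (c ·_) u

mul-outer : ∀ {n k} (u : Vecₙ k) (c y : Vecₙ n) → mul (outer u c) y ≡ u · dot c y
mul-outer [] c y = refl
mul-outer (a ∷ u) c y = cong₂ _∷_ (trans (dot-·ˡ c y a) (∧-comm (dot c y) a)) (mul-outer u c y)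

infixl 6 _⊞_
_⊞_ : ∀ {n k} → Vec (Vecₙ n) k → Vec (Vecₙ n) k → Vec (Vecₙ n) k
_⊞_ = zipWith _⊕_

mul-⊞ : ∀ {n k} (A B : Vec (Vecₙ n) k) y → mul (A ⊞ B) y ≡ mul A y ⊕ mul B y
mul-⊞ [] [] y = refl
mul-⊞ (a ∷ A) (b ∷ B) y = cong₂ _∷_ (dot-⊕ˡ a b y) (mul-⊞ A B y)

symmetric-outer : ∀ {m} → Vecₙ m → Vecₙ m → Mat m
symmetric-outer u c = outer u c ⊞ outer c u

act-symmetric-outer : ∀ {m} (u c y : Vecₙ m) →
  act (symmetric-outer u c) y ≡ u · dot c y ⊕ c · dot u y
act-symmetric-outer u c y =
  trans (mul-⊞ (outer u c) (outer c u) y) (cong₂ _⊕_ (mul-outer u c y) (mul-outer c u y))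

symmetric-outer-alternating : ∀ {m} (u c : Vecₙ m) → Alternating (symmetric-outer u c)
symmetric-outer-alternating u c y = begin
  dot (act (symmetric-outer u c) y) y                ≡⟨ cong (λ t → dot t y) (act-symmetric-outer u c y) ⟩
  dot (u · dot c y ⊕ c · dot u y) y                  ≡⟨ dot-⊕ˡ (u · dot c y) (c · dot u y) y ⟩
  dot (u · dot c y) y xor dot (c · dot u y) y        ≡⟨ cong₂ _xor_ (dot-·ˡ u y (dot c y)) (dot-·ˡ c y (dot u y)) ⟩
  (dot u y ∧ dot c y) xor (dot c y ∧ dot u y)        ≡⟨ cong (_xor (dot c y ∧ dot u y)) (∧-comm (dot u y) (dot c y)) ⟩
  (dot c y ∧ dot u y) xor (dot c y ∧ dot u y)        ≡⟨ xor-same (dot c y ∧ dot u y) ⟩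
  false                                              ∎

-- GL(m,2) is transitive on non-zero vectors.

e₁ : ∀ {k} → Vecₙ (suc k)
e₁ = true ∷ zeroV

dot-e₁ : ∀ {k} b (x : Vecₙ k) → dot (b ∷ x) e₁ ≡ b
dot-e₁ b x = trans (cong₂ _xor_ (∧-identityʳ b) (dot-zeroʳ x)) (xor-identityʳ b)

elementary : ∀ {k} → Vecₙ k → Vecₙ k → Mat (suc k)
elementary p q = (true ∷ p) ∷ zipWith _∷_ q idMat

act-elementary : ∀ {k} (p q : Vecₙ k) b y →
  act (elementary p q) (b ∷ y) ≡ (b xor dot p y) ∷ (q · b ⊕ y)
act-elementary p q b y =
  cong ((b xor dot p y) ∷_) (trans (mul-column q idMat b y) (cong (q · b ⊕_) (act-id y)))

rowOp : ∀ {k} → Vecₙ k → Invertible (suc k)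
rowOp w = involution (elementary w zeroV) twice
  where
  step : ∀ b y → act (elementary w zeroV) (b ∷ y) ≡ (b xor dot w y) ∷ y
  step b y = trans (act-elementary w zeroV b y)
                   (cong ((b xor dot w y) ∷_) (trans (cong (_⊕ y) (zero-· b)) (⊕-identityˡ y)))
  twice : ∀ v → act (elementary w zeroV) (act (elementary w zeroV) v) ≡ v
  twice (b ∷ y) = begin
    act (elementary w zeroV) (act (elementary w zeroV) (b ∷ y))  ≡⟨ cong (act (elementary w zeroV)) (step b y) ⟩
    act (elementary w zeroV) ((b xor dot w y) ∷ y)               ≡⟨ step _ y ⟩
    ((b xor dot w y) xor dot w y) ∷ y                            ≡⟨ cong (_∷ y) (xor-assoc b _ _) ⟩
    (b xor (dot w y xor dot w y)) ∷ y                            ≡⟨ cong (λ t → (b xor t) ∷ y) (xor-same (dot w y)) ⟩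
    (b xor false) ∷ y                                            ≡⟨ cong (_∷ y) (xor-identityʳ b) ⟩
    b ∷ y                                                        ∎

columnOp : ∀ {k} → Vecₙ k → Invertible (suc k)
columnOp w = involution (elementary zeroV w) twice
  where
  step : ∀ b y → act (elementary zeroV w) (b ∷ y) ≡ b ∷ (w · b ⊕ y)
  step b y = trans (act-elementary zeroV w b y)
                   (cong (_∷ (w · b ⊕ y)) (trans (cong (b xor_) (dot-zeroˡ y)) (xor-identityʳ b)))
  twice : ∀ v → act (elementary zeroV w) (act (elementary zeroV w) v) ≡ v
  twice (b ∷ y) = trans (cong (act (elementary zeroV w)) (step b y))
                        (trans (step b _) (cong (b ∷_) (⊕-cancelˡ (w · b) y)))

columnOp-e₁ : ∀ {k} (x : Vecₙ k) → act (Invertible.M (columnOp x)) (true ∷ x) ≡ e₁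
columnOp-e₁ x = begin
  act (elementary zeroV x) (true ∷ x)     ≡⟨ act-elementary zeroV x true x ⟩
  (true xor dot zeroV x) ∷ (x · true ⊕ x) ≡⟨ cong₂ (λ a b → (true xor a) ∷ (b ⊕ x)) (dot-zeroˡ x) (·-true x) ⟩
  true ∷ (x ⊕ x)                          ≡⟨ cong (true ∷_) (⊕-self x) ⟩
  e₁                                      ∎

-- If x = (0 ; x′),
-- take g′ with g′x′ = e₁; its first row w has wᵀx′ = 1, so a row operation
-- makes the first coordinate 1 and a column operation clears the rest.
GL-transitive : ∀ k (x : Vecₙ (suc k)) → ¬ x ≡ zeroV → Σ (Invertible (suc k)) (λ g → act (Invertible.M g) x ≡ e₁)
GL-transitive k (true ∷ x′) _ = columnOp x′ , columnOp-e₁ x′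
GL-transitive zero (false ∷ []) x≢0 = ⊥-elim (x≢0 refl)
GL-transitive (suc k) (false ∷ x′) x≢0 with GL-transitive k x′ (x≢0 ∘ cong (false ∷_))
... | g′ , g′x′≡e₁ = compose (columnOp x′) (rowOp w) , reaches-e₁
  where
  w : Vecₙ (suc k)
  w = lookup (Invertible.M g′) zero
  w·x′≡1 : dot w x′ ≡ true
  w·x′≡1 = trans (sym (lookup-map zero _ (Invertible.M g′))) (cong (λ v → lookup v zero) g′x′≡e₁)
  reaches-e₁ : act (elementary zeroV x′ ⊗ elementary w zeroV) (false ∷ x′) ≡ e₁
  reaches-e₁ = begin
    act (elementary zeroV x′ ⊗ elementary w zeroV) (false ∷ x′)
      ≡⟨ act-⊗ (elementary zeroV x′) (elementary w zeroV) (false ∷ x′) ⟩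
    act (elementary zeroV x′) (act (elementary w zeroV) (false ∷ x′))
      ≡⟨ cong (act (elementary zeroV x′)) (act-elementary w zeroV false x′) ⟩
    act (elementary zeroV x′) (dot w x′ ∷ (zeroV · false ⊕ x′))
      ≡⟨ cong₂ (λ a b → act (elementary zeroV x′) (a ∷ b)) w·x′≡1
                (trans (cong (_⊕ x′) (zero-· false)) (⊕-identityˡ x′)) ⟩
    act (elementary zeroV x′) (true ∷ x′)
      ≡⟨ columnOp-e₁ x′ ⟩
    e₁ ∎

zero-++ : ∀ m {n} → zeroV {m} ++ zeroV {n} ≡ zeroV
zero-++ zero = refl
zero-++ (suc m) = cong (false ∷_) (zero-++ m)

orbit-split : ∀ {m} v w → Orbit m (top m v ++ bot m v) w → Orbit m v w
orbit-split {m} v w = subst (λ u → Orbit m u w) (take++drop≡id m v)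

-- Normal forms in dimension 2m with m = 1 + k, so that e₁ exists.
module NormalForms (k : ℕ) where

  m : ℕ
  m = suc k

  repS : Vecₙ (m + m)
  repS = e₁ {k} ++ zeroV

  -- (c e₁ ; e₁), whose value of v₁ᵀv₂ is c.
  rep : F₂ → Vecₙ (m + m)
  rep c = (c ∷ zeroV) ++ e₁

  repQ repN : Vecₙ (m + m)
  repQ = rep false
  repN = rep true

  repS-block : Block₁ m repS
  repS-block = inS m e₁ zeroV refl , λ ()

  repQ-block : Block₂ m repQ
  repQ-block = inQ m zeroV e₁ (dot-zeroˡ (e₁ {k})) , λ s → case (inS⁻¹ m zeroV e₁ s)
    where
    case : ¬ (e₁ {k} ≡ zeroV)
    case ()

  repN-block : Block₃ m repN
  repN-block q = case (trans (sym (dot-e₁ true (zeroV {k}))) (inQ⁻¹ m e₁ e₁ q))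
    where
    case : ¬ (true ≡ false)
    case ()

  -- (x ; 0) with x ≠ 0 is moved to (e₁ ; 0) by diag(P, (P⁻¹)ᵀ) where Px = e₁.
  top-to-e₁ : ∀ (x : Vecₙ m) → ¬ x ≡ zeroV → Orbit m (x ++ zeroV) repS
  top-to-e₁ x x≢0 with GL-transitive k x x≢0
  ... | g , Mx≡e₁ = diagonalTop g ,
    trans (act-diag M (transpose M⁻¹) x zeroV) (cong₂ _++_ Mx≡e₁ (mul-zero (transpose M⁻¹)))
    where open Invertible g

  -- (x ; y) with y ≠ 0 is moved to some (x′ ; e₁) by diag((P⁻¹)ᵀ, P) where
  -- Py = e₁; the invariant xᵀy becomes x′ᵀe₁.
  bottom-to-e₁ : ∀ (x y : Vecₙ m) → ¬ y ≡ zeroV →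
    Σ (Vecₙ m) (λ x′ → Orbit m (x ++ y) (x′ ++ e₁) × dot x′ e₁ ≡ dot x y)
  bottom-to-e₁ x y y≢0 with GL-transitive k y y≢0
  ... | g , My≡e₁ = act (transpose M⁻¹) x ,
    (diagonalBottom g , trans (act-diag (transpose M⁻¹) M x y) (cong (act (transpose M⁻¹) x ++_) My≡e₁)) ,
    trans (cong (dot (act (transpose M⁻¹) x)) (sym My≡e₁)) (dual-adjoint g x y)
    where open Invertible g

  -- (b ∷ x′ ; e₁) is moved to (b ∷ 0 ; e₁) by the shear with u e₁ᵀ + e₁ uᵀ,
  -- u = (0 ∷ x′), which adds u to the top half.
  clear-top : ∀ b (x′ : Vecₙ k) → Orbit m ((b ∷ x′) ++ e₁) (rep b)
  clear-top b x′ = shearH A (symmetric-outer-alternating u e₁) , (begin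
    act (shear A) ((b ∷ x′) ++ e₁)  ≡⟨ act-shear A (b ∷ x′) e₁ ⟩
    ((b ∷ x′) ⊕ act A e₁) ++ e₁     ≡⟨ cong (λ t → ((b ∷ x′) ⊕ t) ++ e₁) Ae₁≡u ⟩
    ((b ∷ x′) ⊕ u) ++ e₁            ≡⟨ cong₂ (λ a t → (a ∷ t) ++ e₁) (xor-identityʳ b) (⊕-self x′) ⟩
    (b ∷ zeroV) ++ e₁               ∎)
    where
    u : Vecₙ m
    u = false ∷ x′
    A : Mat m
    A = symmetric-outer u e₁
    Ae₁≡u : act A e₁ ≡ u
    Ae₁≡u = begin
      act A e₁                         ≡⟨ act-symmetric-outer u e₁ e₁ ⟩
      u · dot (e₁ {k}) e₁ ⊕ e₁ · dot u e₁ ≡⟨ cong₂ (λ a c → u · a ⊕ e₁ {k} · c) (dot-e₁ true (zeroV {k})) (dot-e₁ false x′) ⟩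
      u · true ⊕ e₁ · false            ≡⟨ cong₂ _⊕_ (·-true u) (cong (false ∷_) (zero-· {k} false)) ⟩
      u ⊕ zeroV                        ≡⟨ ⊕-identityʳ u ⟩
      u                                ∎

  outside-S : ∀ v → ¬ InS m v → Orbit m v (rep (dot (top m v) (bot m v)))
  outside-S v v∉S with bottom-to-e₁ (top m v) (bot m v) v∉S
  ... | b ∷ x′ , v~x′e₁ , x′e₁≡v₁v₂ = orbit-trans (orbit-split v _ v~x′e₁)
    (subst (λ c → Orbit m ((b ∷ x′) ++ e₁) (rep c))
           (trans (sym (dot-e₁ b x′)) x′e₁≡v₁v₂) (clear-top b x′))

  S-orbit : ∀ v → Block₁ m v → Orbit m v repS
  S-orbit v (v∈S , v≢0) =
    orbit-split v repS (subst (λ y → Orbit m (top m v ++ y) repS) (sym v∈S) (top-to-e₁ (top m v) v₁≢0))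
    where
    v₁≢0 : ¬ top m v ≡ zeroV
    v₁≢0 v₁≡0 = v≢0 (trans (sym (take++drop≡id m v)) (trans (cong₂ _++_ v₁≡0 v∈S) (zero-++ m)))

  -- Q∖S and F₂^{2m}∖Q: the invariant v₁ᵀv₂ is 0, respectively 1.
  Q-orbit : ∀ v → Block₂ m v → Orbit m v repQ
  Q-orbit v (v∈Q , v∉S) = subst (λ c → Orbit m v (rep c)) v∈Q (outside-S v v∉S)

  N-orbit : ∀ v → Block₃ m v → Orbit m v repN
  N-orbit v v∉Q = subst (λ c → Orbit m v (rep c)) (¬-not v∉Q) (outside-S v v∉S)
    where
    v∉S : ¬ InS m v
    v∉S v∈S = v∉Q (trans (cong (dot (top m v)) v∈S) (dot-zeroʳ (top m v)))

  sameBlock⇒orbit : ∀ v w → SameBlock m v w → Orbit m v w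
  sameBlock⇒orbit v w (inj₁ (refl , refl)) = orbit-refl v
  sameBlock⇒orbit v w (inj₂ (inj₁ (v∈B , w∈B))) = orbit-trans (S-orbit v v∈B) (orbit-sym (S-orbit w w∈B))
  sameBlock⇒orbit v w (inj₂ (inj₂ (inj₁ (v∈B , w∈B)))) = orbit-trans (Q-orbit v v∈B) (orbit-sym (Q-orbit w w∈B))
  sameBlock⇒orbit v w (inj₂ (inj₂ (inj₂ (v∈B , w∈B)))) = orbit-trans (N-orbit v v∈B) (orbit-sym (N-orbit w w∈B))

invariant : ∀ {n} (g : Invertible n) (X : Vecₙ n → Set) →
  Preserves (Invertible.M g) X → Preserves (Invertible.M⁻¹ g) X → ∀ v → X v ⇔ X (act (Invertible.M g) v)
invariant g X pM pM⁻¹ v = mk⇔ (pM v) (λ x → subst X (Invertible.left g v) (pM⁻¹ _ x))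

preserves-zero : ∀ {n} (M : Mat n) → Preserves M (_≡ zeroV)
preserves-zero M v v≡0 = trans (cong (act M) v≡0) (mul-zero M)

sameBlock-intro : ∀ m v w → (v ≡ zeroV ⇔ w ≡ zeroV) → (InS m v ⇔ InS m w) → (InQ m v ⇔ InQ m w) →
  SameBlock m v w
sameBlock-intro m v w zero⇔ S⇔ Q⇔
  with ≡-dec _≟ᵇ_ v zeroV | ≡-dec _≟ᵇ_ (bot m v) zeroV | dot (top m v) (bot m v) ≟ᵇ false
... | yes v≡0 | _       | _       = inj₁ (v≡0 , to zero⇔ v≡0)
... | no v≢0  | yes v∈S | _       = inj₂ (inj₁ ((v∈S , v≢0) , (to S⇔ v∈S , v≢0 ∘ from zero⇔)))
... | no _    | no v∉S  | yes v∈Q = inj₂ (inj₂ (inj₁ ((v∈Q , v∉S) , (to Q⇔ v∈Q , v∉S ∘ from S⇔))))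
... | no _    | no _    | no v∉Q  = inj₂ (inj₂ (inj₂ (v∉Q , v∉Q ∘ from Q⇔)))

orbit⇒sameBlock : ∀ {m} v w → Orbit m v w → SameBlock m v w
orbit⇒sameBlock {m} v w (h , refl) = sameBlock-intro m v (act M v)
  (invariant g (_≡ zeroV) (preserves-zero M) (preserves-zero M⁻¹) v)
  (invariant g (InS m) M-S M⁻¹-S v)
  (invariant g (InQ m) M-Q M⁻¹-Q v)
  where open Symmetry h

mainTheorem4 : (m : ℕ) → 1 ≤ m →
    (Inhabited (Block₀ m) × Inhabited (Block₁ m) × Inhabited (Block₂ m) × Inhabited (Block₃ m)) ×
    (∀ v w → SameOrbit m v w ⇔ SameBlock m v w)
mainTheorem4 (suc k) _ = blocks-inhabited , λ v w →
  mk⇔ (orbit⇒sameBlock v w ∘ SameOrbit-orbit) (orbit-SameOrbit ∘ sameBlock⇒orbit v w)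
  where
  open NormalForms k
  blocks-inhabited : Inhabited (Block₀ m) × Inhabited (Block₁ m) × Inhabited (Block₂ m) × Inhabited (Block₃ m)
  blocks-inhabited = (zeroV , refl) , (repS , repS-block) , (repQ , repQ-block) , (repN , repN-block)
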